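{- The molecular graph of neopentane is not a $G_\phi$-graph. Here the molecular graph of neopentane is the tree consisting of a central vertex $u$ adjacent to four vertices $c_1,c_2,c_3,c_4$, where each $c_i$ is additionally adjacent to three leaves (so $17$ vertices in total).
   Context: $\phi$ denotes Euler's totient function, $\phi^0(n)=n$ and $\phi^i(n)=\phi(\phi^{i-1}(n))$. For a set $A$ of positive integers, $A_\phi=\{\phi^k(n): n\in A,\ k\ge 0\}$, and $G_\phi(A)$ is the simple graph with vertex set $A_\phi$ in which distinct vertices $r,s$ are adjacent iff $\phi(r)=s$ or $\phi(s)=r$. A graph $H$ is a $G_\phi$-graph if $H$ is isomorphic to $G_\phi(A)$ for some set $A$ of positive integers. -}

module Defs where

open import Data.Nat using (ℕ; zero; suc; _≤_; _≟_)
open import Data.Nat.GCD using (gcd)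
open import Data.List using (List; length; filter; map; upTo)
open import Data.Fin using (Fin)
open import Data.Product using (Σ; ∃; _×_; _,_)
open import Data.Sum using (_⊎_)
open import Function using (_∘_)
open import Function.Bundles using (_⇔_)
open import Function.Definitions using (Injective)
open import Relation.Binary.PropositionalEquality using (_≡_; _≢_)

φ : ℕ → ℕ
φ n = length (filter (λ k → gcd k n ≟ 1) (map suc (upTo n)))

φ^ : ℕ → ℕ → ℕ
φ^ zero    n = n
φ^ (suc i) n = φ (φ^ i n)

PositiveSet : (ℕ → Set) → Set
PositiveSet A = ∀ n → A n → 1 ≤ n

InAφ : (ℕ → Set) → ℕ → Set
InAφ A m = Σ ℕ λ n → Σ ℕ λ k → A n × φ^ k n ≡ m

GφAdj : ℕ → ℕ → Set
GφAdj r s = r ≢ s × (φ r ≡ s ⊎ φ s ≡ r)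

IsGφGraph : (V : Set) → (V → V → Set) → Set₁
IsGφGraph V E =
  Σ (ℕ → Set) λ A → PositiveSet A ×
    Σ (V → ℕ) λ f →
      Injective _≡_ _≡_ f ×
      (∀ v → InAφ A (f v)) ×
      (∀ m → InAφ A m → ∃ λ v → f v ≡ m) ×
      (∀ v w → E v w ⇔ GφAdj (f v) (f w))

data NeoV : Set where
  u    : NeoV
  c    : Fin 4 → NeoV
  leaf : Fin 4 → Fin 3 → NeoV

data NeoAdj : NeoV → NeoV → Set where
  u-c    : ∀ i → NeoAdj u (c i)
  c-u    : ∀ i → NeoAdj (c i) u
  c-leaf : ∀ i j → NeoAdj (c i) (leaf i j)
  leaf-c : ∀ i j → NeoAdj (leaf i j) (c i)

{-# OPTIONS --safe #-}
-- Suppose f labels neopentane bijectively by A_φ. Iterating φ from any element of A reaches 1, so some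
-- vertex is labelled 1. Its neighbours are labelled by φ-preimages of 1 other than 1, i.e. by 2, so by
-- injectivity it is a leaf. Then its carbon is labelled 2, the centre by some x with φ x = 2, and the
-- other three carbons by three preimages of x, each of which has three preimages (its leaves). But
-- φ x = 2 forces x ∈ {3, 4, 6}, and at most two preimages of each of these have three preimages.
-- These preimage sets are computable because φ n ≥ 11 for n > 30: by evaluation up to 544, and
-- beyond by exhibiting eleven explicit residues prime to n, chosen according to n = 2^a m with m odd.
module Submission where

open import Defs
open import Data.Bool using (T; true; false)
open import Data.Fin using (Fin; zero; suc; punchIn)
import Data.Fin.Properties as Fin
open import Data.List using (List; []; _∷_; length; filter; map; upTo; applyUpTo; applyDownFrom; reverse; lookup)
open import Data.List.Properties using (filter-accept; filter-notAll; map-upTo; length-map; length-upTo; reverse-applyUpTo)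
open import Data.List.Membership.Propositional using (_∈_; lose)
open import Data.List.Membership.Propositional.Properties using (∈-applyUpTo⁺; ∈-upTo⁺; ∈-filter⁺)
open import Data.List.Relation.Binary.Permutation.Propositional using (↭-sym)
open import Data.List.Relation.Binary.Permutation.Propositional.Properties using (↭-length; ↭-reverse; filter-↭)
open import Data.List.Relation.Unary.All as All using (All; all?)
open import Data.List.Relation.Unary.Any using (here; there; index)
open import Data.List.Relation.Unary.Any.Properties using (lookup-index)
open import Data.Nat
open import Data.Nat.Properties
open import Data.Nat.Coprimality as Coprime using (Coprime; 1-coprimeTo; coprime-divisor; gcd≡1⇒coprime; coprime⇒gcd≡1)
open import Data.Nat.Divisibility using (_∣_; divides; ∣-refl; ∣-trans; ∣1⇒≡1; ∣m+n∣m⇒∣n; ∣m∸n∣n⇒∣m; m∣m*n; n∣m*n; ∣n⇒∣m*n; _∣0; _∣?_)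
open import Data.Nat.GCD using (gcd)
open import Data.Nat.Induction using (<-rec)
open import Data.Nat.Primality using (irreducible[2])
open import Data.Product using (Σ; ∃; ∃₂; _×_; _,_; proj₁; proj₂)
open import Data.Sum using (_⊎_; inj₁; inj₂)
open import Data.Unit using (⊤; tt)
open import Function using (_∘_)
open import Function.Bundles using (_⇔_; Equivalence)
open import Function.Definitions using (Injective)
open import Relation.Binary.PropositionalEquality
open import Relation.Nullary using (Dec; does; ¬_; yes; no; contradiction)
open import Relation.Nullary.Decidable using (toWitness; _⊎-dec_; _×-dec_)

-- Counting residues prime to n

coprimeTo? : (n k : ℕ) → Dec (gcd k n ≡ 1)
coprimeTo? n k = gcd k n ≟ 1

data CoprimesBelow (n : ℕ) : ℕ → List ℕ → Set where
  []   : ∀ {b} → CoprimesBelow n b []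
  cons : ∀ {b x xs} → 0 < x → x < b → Coprime x n → CoprimesBelow n x xs → CoprimesBelow n b (x ∷ xs)

length-filter-∷ : ∀ n y ys → length (filter (coprimeTo? n) ys) ≤ length (filter (coprimeTo? n) (y ∷ ys))
length-filter-∷ n y ys with does (coprimeTo? n y)
... | true  = n≤1+n _
... | false = ≤-refl

length≤length-filter-downFrom : ∀ {n xs} N → CoprimesBelow n (suc N) xs →
                                length xs ≤ length (filter (coprimeTo? n) (applyDownFrom suc N))
length≤length-filter-downFrom N [] = z≤n
length≤length-filter-downFrom zero (cons (s≤s _) (s≤s ()) _ _)
length≤length-filter-downFrom {n} {_ ∷ ys} (suc N) (cons 0<x (s≤s x≤1+N) x⊥n rest) with m≤n⇒m<n∨m≡n x≤1+N
... | inj₁ x<1+N = ≤-trans (length≤length-filter-downFrom N (cons 0<x x<1+N x⊥n rest))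
                           (length-filter-∷ n (suc N) (applyDownFrom suc N))
... | inj₂ refl = subst (suc (length ys) ≤_) (cong length (sym accept)) (s≤s (length≤length-filter-downFrom N rest))
  where
  accept : filter (coprimeTo? n) (suc N ∷ applyDownFrom suc N) ≡ suc N ∷ filter (coprimeTo? n) (applyDownFrom suc N)
  accept = filter-accept (coprimeTo? n) (coprime⇒gcd≡1 x⊥n)

φ≡length-filter-downFrom : ∀ n → φ n ≡ length (filter (coprimeTo? n) (applyDownFrom suc n))
φ≡length-filter-downFrom n = begin
  φ n                                                        ≡⟨ cong (length ∘ filter P) (map-upTo suc n) ⟩
  length (filter P (applyUpTo suc n))                        ≡⟨ ↭-length (filter-↭ P (↭-sym (↭-reverse (applyUpTo suc n)))) ⟩
  length (filter P (reverse (applyUpTo suc n)))              ≡⟨ cong (length ∘ filter P) (reverse-applyUpTo suc n) ⟩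
  length (filter P (applyDownFrom suc n))                    ∎
  where open ≡-Reasoning; P = coprimeTo? n

length≤φ : ∀ {n xs} → CoprimesBelow n (suc n) xs → length xs ≤ φ n
length≤φ {n} xs = subst (_ ≤_) (sym (φ≡length-filter-downFrom n)) (length≤length-filter-downFrom n xs)

CoprimesBelow-weaken : ∀ {n b b′ xs} → b ≤ b′ → CoprimesBelow n b xs → CoprimesBelow n b′ xs
CoprimesBelow-weaken b≤b′ []                    = []
CoprimesBelow-weaken b≤b′ (cons 0<x x<b x⊥n xs) = cons 0<x (<-≤-trans x<b b≤b′) x⊥n xs

φ-positive : ∀ {n} → 0 < n → 0 < φ n
φ-positive {n} 0<n = length≤φ (cons ≤-refl (s≤s 0<n) (1-coprimeTo n) [])

φ<n : ∀ {n} → 1 < n → φ n < n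
φ<n {n@(suc _)} 1<n = subst (φ n <_) range-length (filter-notAll (coprimeTo? n) range (lose n∈range gcd[n,n]≢1))
  where
  range : List ℕ
  range = map suc (upTo n)
  range-length : length range ≡ n
  range-length = trans (length-map suc (upTo n)) (length-upTo n)
  n∈range : n ∈ range
  n∈range = subst (n ∈_) (sym (map-upTo suc n)) (∈-applyUpTo⁺ suc ≤-refl)
  gcd[n,n]≢1 : gcd n n ≢ 1
  gcd[n,n]≢1 gcd≡1 = >⇒≢ 1<n (gcd≡1⇒coprime gcd≡1 (∣-refl , ∣-refl))

φ^-suc : ∀ k n → φ^ (suc k) n ≡ φ^ k (φ n)
φ^-suc zero    n = refl
φ^-suc (suc k) n = cong φ (φ^-suc k n)

φ^-reaches-1 : ∀ n → 0 < n → ∃ λ k → φ^ k n ≡ 1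
φ^-reaches-1 = <-rec _ step
  where
  step : ∀ n → (∀ {m} → m < n → 0 < m → ∃ λ k → φ^ k m ≡ 1) → 0 < n → ∃ λ k → φ^ k n ≡ 1
  step (suc zero)          _   _ = 0 , refl
  step n@(suc (suc _)) rec _ with k , φ^k[φn]≡1 ← rec (φ<n (s≤s (s≤s z≤n))) (φ-positive {n} (s≤s z≤n)) =
    suc k , trans (φ^-suc k n) φ^k[φn]≡1

-- φ n ≥ 11 for n > 30

≤-numeral : ∀ {m n} {_ : T (m ≤ᵇ n)} → m ≤ n
≤-numeral {m} {n} {m≤ᵇn} = ≤ᵇ⇒≤ m n m≤ᵇn

coprime-∣ˡ : ∀ {m n d} → Coprime m n → d ∣ m → Coprime d n
coprime-∣ˡ m⊥n d∣m (e∣d , e∣n) = m⊥n (∣-trans e∣d d∣m , e∣n)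

coprime-∣ʳ : ∀ {m n d} → Coprime m n → d ∣ n → Coprime m d
coprime-∣ʳ m⊥n d∣n = Coprime.sym (coprime-∣ˡ (Coprime.sym m⊥n) d∣n)

coprime-*ʳ : ∀ {m n o} → Coprime m n → Coprime m o → Coprime m (n * o)
coprime-*ʳ m⊥n m⊥o (d∣m , d∣no) = m⊥o (d∣m , coprime-divisor (coprime-∣ˡ m⊥n d∣m) d∣no)

coprime-^ʳ : ∀ {m n} → Coprime m n → ∀ a → Coprime m (n ^ a)
coprime-^ʳ {m} m⊥n zero    = Coprime.sym (1-coprimeTo m)
coprime-^ʳ     m⊥n (suc a) = coprime-*ʳ m⊥n (coprime-^ʳ m⊥n a)

coprime-∸ : ∀ {k n} → Coprime k n → k ≤ n → Coprime (n ∸ k) n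
coprime-∸ {k} {n} k⊥n k≤n (d∣n∸k , d∣n) = k⊥n (∣m+n∣m⇒∣n (subst (_ ∣_) (sym (m∸n+n≡m k≤n)) d∣n) d∣n∸k , d∣n)

odd⇒coprime-2 : ∀ {m} → ¬ 2 ∣ m → Coprime m 2
odd⇒coprime-2 2∤m {d} (d∣m , d∣2) with irreducible[2] d∣2
... | inj₁ d≡1 = d≡1
... | inj₂ refl = contradiction d∣m 2∤m

odd-+ : ∀ {e m} → 2 ∣ e → ¬ 2 ∣ m → ¬ 2 ∣ (e + m)
odd-+ 2∣e 2∤m 2∣e+m = 2∤m (∣m+n∣m⇒∣n 2∣e+m 2∣e)

odd-∸ : ∀ {e m} → 2 ∣ e → e ≤ m → ¬ 2 ∣ m → ¬ 2 ∣ (m ∸ e)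
odd-∸ 2∣e e≤m 2∤m 2∣m∸e = 2∤m (∣m∸n∣n⇒∣m 2 e≤m 2∣m∸e 2∣e)

2∣2^[1+j] : ∀ j → 2 ∣ 2 ^ suc j
2∣2^[1+j] j = m∣m*n (2 ^ j)

odd-decomposition : ∀ n → 0 < n → ∃₂ λ a m → n ≡ 2 ^ a * m × ¬ 2 ∣ m
odd-decomposition = <-rec _ step
  where
  half< : ∀ {n} q → n ≡ suc q * 2 → suc q < n
  half< q n≡q*2 = subst (suc q <_) (sym n≡q*2) (m<m*n (suc q) 2 ≤-refl)

  step : ∀ n → (∀ {q} → q < n → 0 < q → ∃₂ λ a m → q ≡ 2 ^ a * m × ¬ 2 ∣ m) → 0 < n →
         ∃₂ λ a m → n ≡ 2 ^ a * m × ¬ 2 ∣ m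
  step n rec 0<n with 2 ∣? n
  ... | no 2∤n = 0 , n , sym (+-identityʳ n) , 2∤n
  ... | yes (divides zero n≡0) = contradiction n≡0 (>⇒≢ 0<n)
  ... | yes (divides q@(suc q-1) n≡q*2) with a , m , q≡2^a*m , 2∤m ← rec (half< q-1 n≡q*2) z<s =
    suc a , m , n≡2^[1+a]*m , 2∤m
    where
    open ≡-Reasoning
    n≡2^[1+a]*m : n ≡ 2 ^ suc a * m
    n≡2^[1+a]*m = begin
      n                ≡⟨ n≡q*2 ⟩
      q * 2            ≡⟨ cong (_* 2) q≡2^a*m ⟩
      2 ^ a * m * 2    ≡⟨ *-comm (2 ^ a * m) 2 ⟩
      2 * (2 ^ a * m)  ≡⟨ *-assoc 2 (2 ^ a) m ⟨
      2 ^ suc a * m    ∎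

progression : ℕ → ℕ → List ℕ
progression r zero    = []
progression r (suc K) = suc (K * r) ∷ progression r K

length-progression : ∀ r K → length (progression r K) ≡ K
length-progression r zero    = refl
length-progression r (suc K) = cong suc (length-progression r K)

1+multiple-coprime : ∀ K r → Coprime (suc (K * r)) r
1+multiple-coprime K r (d∣1+Kr , d∣r) =
  ∣1⇒≡1 (∣m+n∣m⇒∣n (subst (_∣_ _) (+-comm 1 (K * r)) d∣1+Kr) (∣n⇒∣m*n K d∣r))

progression-coprimes : ∀ {n r} → 0 < r → (∀ {x} → Coprime x r → Coprime x n) →
                       ∀ K → CoprimesBelow n (suc (K * r)) (progression r K)
progression-coprimes 0<r transfer zero    = []
progression-coprimes 0<r transfer (suc K) =
  cons z<s (s≤s (m<n+m _ 0<r)) (transfer (1+multiple-coprime K _)) (progression-coprimes 0<r transfer K)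

-- 1, 1 + r, 1 + 2r, … are prime to r, hence to n.
progression≤φ : ∀ {n r} K → 0 < r → (∀ {x} → Coprime x r → Coprime x n) → K * r ≤ n → K ≤ φ n
progression≤φ {n} {r} K 0<r transfer Kr≤n = subst (_≤ φ n) (length-progression r K)
  (length≤φ (CoprimesBelow-weaken (s≤s Kr≤n) (progression-coprimes 0<r transfer K)))

11≤φ-2^[5+a]*m : ∀ a m → 0 < m → 11 ≤ φ (2 ^ (5 + a) * m)
11≤φ-2^[5+a]*m a m 0<m = progression≤φ 11 (*-monoʳ-< 2 0<m) transfer bound
  where
  transfer : ∀ {x} → Coprime x (2 * m) → Coprime x (2 ^ (5 + a) * m)
  transfer x⊥2m = coprime-*ʳ (coprime-^ʳ (coprime-∣ʳ x⊥2m (m∣m*n m)) (5 + a)) (coprime-∣ʳ x⊥2m (n∣m*n 2))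
  bound : 11 * (2 * m) ≤ 2 ^ (5 + a) * m
  bound = begin
    11 * (2 * m)    ≡⟨ *-assoc 11 2 m ⟨
    22 * m          ≤⟨ *-monoˡ-≤ m (≤-trans (≤-numeral {22} {32}) (^-monoʳ-≤ 2 (m≤m+n 5 a))) ⟩
    2 ^ (5 + a) * m ∎
    where open ≤-Reasoning

-- 1, 2, 4, …, 32 and their reflections n − 1, n − 2, …, n − 32.
12≤φ-odd : ∀ {n} → ¬ 2 ∣ n → 64 < n → 12 ≤ φ n
12≤φ-odd {n} 2∤n 64<n = length≤φ
  (cons (positive 0) (s≤s (m∸n≤m n 1))       (reflection 0)
  (cons (positive 1) (down {1} {2} ≤-numeral) (reflection 1)
  (cons (positive 2) (down {2} {4} ≤-numeral) (reflection 2)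
  (cons (positive 3) (down {4} {8} ≤-numeral) (reflection 3)
  (cons (positive 4) (down {8} {16} ≤-numeral) (reflection 4)
  (cons (positive 5) (down {16} {32} ≤-numeral) (reflection 5)
  (cons z<s (∸-monoˡ-≤ 32 64<n) (power 5)
  (cons z<s ≤-numeral (power 4)
  (cons z<s ≤-numeral (power 3)
  (cons z<s ≤-numeral (power 2)
  (cons z<s ≤-numeral (power 1)
  (cons z<s ≤-numeral (power 0) []))))))))))))
  where
  power : ∀ j → Coprime (2 ^ j) n
  power j = Coprime.sym (coprime-^ʳ (odd⇒coprime-2 2∤n) j)
  2^j<n : ∀ j → j ≤ 5 → 2 ^ j < n
  2^j<n j j≤5 = ≤-<-trans (^-monoʳ-≤ 2 (≤-trans j≤5 (≤-numeral {5} {6}))) 64<n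
  reflection : ∀ j {_ : T (j ≤ᵇ 5)} → Coprime (n ∸ 2 ^ j) n
  reflection j {j≤5} = coprime-∸ (power j) (<⇒≤ (2^j<n j (≤ᵇ⇒≤ j 5 j≤5)))
  positive : ∀ j {_ : T (j ≤ᵇ 5)} → 0 < n ∸ 2 ^ j
  positive j {j≤5} = m<n⇒0<n∸m (2^j<n j (≤ᵇ⇒≤ j 5 j≤5))
  down : ∀ {a b} → a < b → {_ : T (b ≤ᵇ 32)} → n ∸ b < n ∸ a
  down {a} {b} a<b {b≤32} = ∸-monoʳ-< a<b (<⇒≤ (≤-<-trans (≤-trans (≤ᵇ⇒≤ b 32 b≤32) (≤-numeral {32} {64})) 64<n))

-- n − 1 and the odd numbers m ± 2, m ± 4, …, m ± 32, which are prime to m.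
11≤φ-large-odd-part : ∀ {m n} → ¬ 2 ∣ m → 35 ≤ m → 2 * m ≤ n →
                      (∀ {x} → Coprime x 2 → Coprime x m → Coprime x n) → 11 ≤ φ n
11≤φ-large-odd-part {m} {n} 2∤m 35≤m 2m≤n transfer = length≤φ
  (cons (≤-trans z<s top) (s≤s (m∸n≤m n 1)) (coprime-∸ (1-coprimeTo n) 1≤n)
  (cons z<s top (above 4)
  (cons z<s (+-monoˡ-< m (≤-numeral {17} {32})) (above 3)
  (cons z<s (+-monoˡ-< m (≤-numeral {9} {16})) (above 2)
  (cons z<s (+-monoˡ-< m (≤-numeral {5} {8})) (above 1)
  (cons z<s (+-monoˡ-< m (≤-numeral {3} {4})) (above 0)
  (cons (positive 0) (≤-<-trans (m∸n≤m m 2) (m<n+m m z<s)) (below 0)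
  (cons (positive 1) (down {2} {4} ≤-numeral) (below 1)
  (cons (positive 2) (down {4} {8} ≤-numeral) (below 2)
  (cons (positive 3) (down {8} {16} ≤-numeral) (below 3)
  (cons (positive 4) (down {16} {32} ≤-numeral) (below 4) [])))))))))))
  where
  m+m≤n : m + m ≤ n
  m+m≤n = subst (_≤ n) (cong (m +_) (+-identityʳ m)) 2m≤n
  1≤n : 1 ≤ n
  1≤n = ≤-trans (≤-trans (≤-numeral {1} {35}) 35≤m) (≤-trans (m≤m+n m m) m+m≤n)
  top : 32 + m < n ∸ 1
  top = ∸-monoˡ-≤ 1 (≤-trans (+-monoˡ-≤ m (≤-trans (≤-numeral {34} {35}) 35≤m)) m+m≤n)
  power : ∀ j → Coprime (2 ^ j) m
  power j = Coprime.sym (coprime-^ʳ (odd⇒coprime-2 2∤m) j)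
  small : ∀ j {_ : T (j ≤ᵇ 4)} → 2 ^ suc j < m
  small j {j≤4} = ≤-<-trans (^-monoʳ-≤ 2 (s≤s (≤ᵇ⇒≤ j 4 j≤4))) (≤-trans (≤-numeral {33} {35}) 35≤m)
  above : ∀ j → Coprime (2 ^ suc j + m) n
  above j = transfer (odd⇒coprime-2 (odd-+ (2∣2^[1+j] j) 2∤m))
                     (subst (λ x → Coprime x m) (+-comm m (2 ^ suc j)) (Coprime.coprime-+ (power (suc j))))
  below : ∀ j {_ : T (j ≤ᵇ 4)} → Coprime (m ∸ 2 ^ suc j) n
  below j {j≤4} = transfer (odd⇒coprime-2 (odd-∸ (2∣2^[1+j] j) 2^[1+j]≤m 2∤m)) (coprime-∸ (power (suc j)) 2^[1+j]≤m)
    where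
    2^[1+j]≤m : 2 ^ suc j ≤ m
    2^[1+j]≤m = <⇒≤ (small j {j≤4})
  positive : ∀ j {_ : T (j ≤ᵇ 4)} → 0 < m ∸ 2 ^ suc j
  positive j {j≤4} = m<n⇒0<n∸m (small j {j≤4})
  down : ∀ {a b} → a < b → {_ : T (b ≤ᵇ 32)} → m ∸ b < m ∸ a
  down {a} {b} a<b {b≤32} = ∸-monoʳ-< a<b (≤-trans (≤ᵇ⇒≤ b 32 b≤32) (≤-trans (≤-numeral {32} {35}) 35≤m))

11≤φ-even : ∀ a m → ¬ 2 ∣ m → 544 < 2 ^ suc a * m → 11 ≤ φ (2 ^ suc a * m)
11≤φ-even a m 2∤m 544<n with 35 ≤? m | a ≤? 3
... | yes 35≤m | _ = 11≤φ-large-odd-part 2∤m 35≤m (*-monoˡ-≤ m (^-monoʳ-≤ 2 {1} {suc a} (s≤s z≤n))) transfer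
  where
  transfer : ∀ {x} → Coprime x 2 → Coprime x m → Coprime x (2 ^ suc a * m)
  transfer x⊥2 x⊥m = coprime-*ʳ (coprime-^ʳ x⊥2 (suc a)) x⊥m
-- otherwise n ≤ 2⁴ · 34 = 544
... | no m≱35 | yes a≤3 = contradiction (*-mono-≤ (^-monoʳ-≤ 2 (s≤s a≤3)) (≤-pred (≰⇒> m≱35))) (<⇒≱ 544<n)
... | no _    | no a≰3 = subst (λ k → 11 ≤ φ (2 ^ suc k * m)) (m+[n∸m]≡n (≰⇒> a≰3))
                                (11≤φ-2^[5+a]*m (a ∸ 4) m 0<m)
  where
  0<m : 0 < m
  0<m = n≢0⇒n>0 (λ { refl → 2∤m (2 ∣0) })

11≤φ-beyond-544 : ∀ {n} → 544 < n → 11 ≤ φ n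
11≤φ-beyond-544 {n} 544<n with odd-decomposition n (≤-trans z<s 544<n)
... | zero , m , n≡m+0 , 2∤m = ≤-trans (n≤1+n 11) (12≤φ-odd 2∤n (≤-trans ≤-numeral 544<n))
  where
  2∤n : ¬ 2 ∣ n
  2∤n = 2∤m ∘ subst (2 ∣_) (trans n≡m+0 (+-identityʳ m))
... | suc a , m , refl , 2∤m = 11≤φ-even a m 2∤m 544<n

-- Abstract, so that unification never unfolds this large evaluated proof.
abstract
  11≤φ-table : All (λ n → n ≤ 30 ⊎ 11 ≤ φ n) (upTo 545)
  11≤φ-table = toWitness {a? = all? (λ n → (n ≤? 30) ⊎-dec (11 ≤? φ n)) (upTo 545)} _

11≤φ-upTo-544 : ∀ {n} → n ≤ 544 → n ≤ 30 ⊎ 11 ≤ φ n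
11≤φ-upTo-544 n≤544 = All.lookup 11≤φ-table (∈-upTo⁺ (s≤s n≤544))

11≤φ : ∀ {n} → 30 < n → 11 ≤ φ n
11≤φ {n} 30<n with n ≤? 544
... | no n≰544 = 11≤φ-beyond-544 (≰⇒> n≰544)
... | yes n≤544 with 11≤φ-upTo-544 n≤544
...   | inj₁ n≤30  = contradiction n≤30 (<⇒≱ 30<n)
...   | inj₂ 11≤φn = 11≤φn

φ≤10⇒≤30 : ∀ {n} → φ n ≤ 10 → n ≤ 30
φ≤10⇒≤30 {n} φn≤10 with n ≤? 30
... | yes n≤30 = n≤30
... | no  n≰30 = contradiction (11≤φ (≰⇒> n≰30)) (<⇒≱ (s≤s φn≤10))

-- Small totient preimages

injective⇒≤length : ∀ {A : Set} {k} {xs : List A} (g : Fin k → A) → Injective _≡_ _≡_ g →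
                    (∀ j → g j ∈ xs) → k ≤ length xs
injective⇒≤length {k = k} {xs} g g-injective g∈xs with length xs <? k
... | no  length≮k = ≮⇒≥ length≮k
... | yes length<k with i , j , i<j , same-index ← Fin.pigeonhole length<k (index ∘ g∈xs) =
  contradiction (g-injective gi≡gj) (Fin.<⇒≢ i<j)
  where
  gi≡gj : g i ≡ g j
  gi≡gj = trans (lookup-index (g∈xs i)) (trans (cong (lookup xs) same-index) (sym (lookup-index (g∈xs j))))

Preimages : ℕ → (ℕ → Set) → ℕ → Set
Preimages k P z = Σ (Fin k → ℕ) λ g → Injective _≡_ _≡_ g × (∀ j → φ (g j) ≡ z × P (g j))

-- Complete only for z ≤ 10: see ∈-preimages.
preimages : ℕ → List ℕ
preimages z = filter (λ a → φ a ≟ z) (upTo 31)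

∈-preimages : ∀ {a z} → z ≤ 10 → φ a ≡ z → a ∈ preimages z
∈-preimages {a} {z} z≤10 φa≡z =
  ∈-filter⁺ (λ a → φ a ≟ z) (∈-upTo⁺ (s≤s (φ≤10⇒≤30 (subst (_≤ 10) (sym φa≡z) z≤10)))) φa≡z

Preimages⇒≤length : ∀ {k P z} → z ≤ 10 → Preimages k P z → k ≤ length (preimages z)
Preimages⇒≤length z≤10 (g , g-injective , φg) = injective⇒≤length g g-injective (∈-preimages z≤10 ∘ proj₁ ∘ φg)

φ≡1⇒1∨2 : ∀ {a} → φ a ≡ 1 → a ≡ 1 ⊎ a ≡ 2
φ≡1⇒1∨2 φa≡1 with ∈-preimages (s≤s z≤n) φa≡1
... | here a≡1 = inj₁ a≡1
... | there (here a≡2) = inj₂ a≡2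

-- A decidable necessary condition for z to have three preimages.
Branching : ℕ → Set
Branching z = 10 < z ⊎ 3 ≤ length (preimages z)

branching? : ∀ z → Dec (Branching z)
branching? z = (10 <? z) ⊎-dec (3 ≤? length (preimages z))

Preimages⇒Branching : ∀ {P z} → Preimages 3 P z → Branching z
Preimages⇒Branching {P} {z} fan with 10 <? z
... | yes 10<z = inj₁ 10<z
... | no  10≮z = inj₂ (Preimages⇒≤length {P = P} (≮⇒≥ 10≮z) fan)

branchingPreimages : ℕ → List ℕ
branchingPreimages x = filter branching? (preimages x)

φ⁻¹[2]-table : All (λ x → x ≤ 10 × length (branchingPreimages x) < 3) (preimages 2)
φ⁻¹[2]-table = toWitness {a? = all? (λ x → (x ≤? 10) ×-dec (length (branchingPreimages x) <? 3)) (preimages 2)} _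

φ≡2⇒¬Preimages-of-Preimages : ∀ {x} → φ x ≡ 2 → ¬ Preimages 3 (Preimages 3 (λ _ → ⊤)) x
φ≡2⇒¬Preimages-of-Preimages {x} φx≡2 (g , g-injective , φg) = <⇒≱ few (injective⇒≤length g g-injective g∈branching)
  where
  x≤10×few : x ≤ 10 × length (branchingPreimages x) < 3
  x≤10×few = All.lookup φ⁻¹[2]-table (∈-preimages (s≤s (s≤s z≤n)) φx≡2)
  few : length (branchingPreimages x) < 3
  few = proj₂ x≤10×few
  g∈branching : ∀ j → g j ∈ branchingPreimages x
  g∈branching j = ∈-filter⁺ branching? (∈-preimages (proj₁ x≤10×few) (proj₁ (φg j))) (Preimages⇒Branching (proj₂ (φg j)))

-- Labellings of neopentane

1∈Aφ : ∀ {A m} → PositiveSet A → InAφ A m → InAφ A 1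
1∈Aφ pos (n , _ , An , _) with k , φ^k[n]≡1 ← φ^-reaches-1 n (pos n An) = n , k , An , φ^k[n]≡1

module Labelling {V : Set} {E : V → V → Set} {f : V → ℕ} (f-injective : Injective _≡_ _≡_ f)
                 (f-adjacency : ∀ v w → E v w ⇔ GφAdj (f v) (f w)) where

  -- The only neighbour of v above it is φ v; every other neighbour lies below.
  child : ∀ {p v w} → E v w → φ (f v) ≡ f p → p ≢ w → φ (f w) ≡ f v
  child {p} {v} {w} e φv≡p p≢w with Equivalence.to (f-adjacency v w) e
  ... | _ , inj₁ φv≡w = contradiction (f-injective (trans (sym φv≡p) φv≡w)) p≢w
  ... | _ , inj₂ φw≡v = φw≡v

  neighbour-of-1 : ∀ {v w} → f v ≡ 1 → E v w → f w ≡ 2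
  neighbour-of-1 {v} {w} fv≡1 e with Equivalence.to (f-adjacency v w) e
  ... | fv≢fw , inj₁ φv≡w = contradiction (trans fv≡1 (trans (sym (cong φ fv≡1)) φv≡w)) fv≢fw
  ... | fv≢fw , inj₂ φw≡v with φ≡1⇒1∨2 (trans φw≡v fv≡1)
  ...   | inj₁ fw≡1 = contradiction (trans fv≡1 (sym fw≡1)) fv≢fw
  ...   | inj₂ fw≡2 = fw≡2

  one-neighbour-of-1 : ∀ {v w w′} → f v ≡ 1 → E v w → E v w′ → w ≡ w′
  one-neighbour-of-1 fv≡1 e e′ = f-injective (trans (neighbour-of-1 fv≡1 e) (sym (neighbour-of-1 fv≡1 e′)))

c-injective : ∀ {i k} → c i ≡ c k → i ≡ k
c-injective refl = refl

leaf-injective : ∀ {i j j′} → leaf i j ≡ leaf i j′ → j ≡ j′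
leaf-injective refl = refl

module _ {f : NeoV → ℕ} (f-injective : Injective _≡_ _≡_ f)
         (f-adjacency : ∀ v w → NeoAdj v w ⇔ GφAdj (f v) (f w)) where
  open Labelling f-injective f-adjacency

  no-vertex-labelled-1 : ∀ v → f v ≢ 1
  no-vertex-labelled-1 u     fu≡1 = contradiction (one-neighbour-of-1 fu≡1 (u-c zero) (u-c (suc zero))) λ ()
  no-vertex-labelled-1 (c i) fc≡1 = contradiction (one-neighbour-of-1 fc≡1 (c-u i) (c-leaf i zero)) λ ()
  no-vertex-labelled-1 (leaf i j) fℓ≡1 = φ≡2⇒¬Preimages-of-Preimages (trans φu≡c fc≡2) fan
    where
    fc≡2 : f (c i) ≡ 2
    fc≡2 = neighbour-of-1 fℓ≡1 (leaf-c i j)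
    φu≡c : φ (f u) ≡ f (c i)
    φu≡c = child (c-u i) (trans (cong φ fc≡2) (sym fℓ≡1)) λ ()
    other : Fin 3 → Fin 4
    other = punchIn i
    φc≡u : ∀ k → φ (f (c (other k))) ≡ f u
    φc≡u k = child (u-c (other k)) φu≡c (Fin.punchInᵢ≢i i k ∘ sym ∘ c-injective)
    φleaf≡c : ∀ k j → φ (f (leaf (other k) j)) ≡ f (c (other k))
    φleaf≡c k j = child (c-leaf (other k) j) (φc≡u k) λ ()
    fan : Preimages 3 (Preimages 3 (λ _ → ⊤)) (f u)
    fan = f ∘ c ∘ other , Fin.punchIn-injective i _ _ ∘ c-injective ∘ f-injective ,
          λ k → φc≡u k , (f ∘ leaf (other k) , leaf-injective ∘ f-injective , λ j → φleaf≡c k j , tt)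

theorem3p2 : ¬ IsGφGraph NeoV NeoAdj
theorem3p2 (_ , pos , f , f-injective , f-in , f-onto , f-adjacency)
  with v , fv≡1 ← f-onto 1 (1∈Aφ pos (f-in u)) = no-vertex-labelled-1 f-injective f-adjacency v fv≡1
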